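{- Let $G$ be a $2$-simultaneous edge colorable graph, let $xy\in E(G)$, let $k\ge 1$, and let $G'$ be the graph obtained from $G$ by replacing the edge $xy$ by a path $xv_1v_2\cdots v_{2k}y$ where $v_1,\ldots,v_{2k}$ are new vertices not in $V(G)$. Then $G'$ is $2$-simultaneous edge colorable.
   Context: All graphs are finite and simple; $[l]=\{1,\ldots,l\}$. A $2$-simultaneous edge coloring of $G$ is a pair $(c_1,c_2)$ of proper edge colorings $c_i:E(G)\to[l]$ with a common color set such that for every vertex $v$ the sets of colors on edges incident to $v$ are the same under $c_1$ and $c_2$, and $c_1(e)\ne c_2(e)$ for every edge $e$; $G$ is $2$-simultaneous edge colorable if such a pair exists for some $l$. -}

module Defs where

open import Data.Nat using (ℕ; zero; suc; _*_; _<?_)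
open import Data.Fin using (Fin; zero; suc; toℕ; fromℕ<; _↑ˡ_; _↑ʳ_; inject₁)
open import Data.Product using (Σ; ∃; _×_; _,_)
open import Relation.Binary.PropositionalEquality using (_≡_; _≢_)
open import Relation.Nullary using (¬_; yes; no)
open import Function.Bundles using (_⇔_)

Rel : ℕ → Set₁
Rel n = Fin n → Fin n → Set

IsSimple : ∀ {n} → Rel n → Set
IsSimple {n} Adj = (∀ u v → Adj u v → Adj v u) × (∀ u → ¬ Adj u u)

-- An edge colouring with colour set [l] (represented as Fin l): a colour for each
-- ordered pair; only values on edges matter, and they must agree on uv and vu.
EdgeColouring : ℕ → ℕ → Set
EdgeColouring n l = Fin n → Fin n → Fin l

IsProperEdgeColouring : ∀ {n l} → Rel n → EdgeColouring n l → Set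
IsProperEdgeColouring {n} Adj c =
  (∀ u v → Adj u v → c u v ≡ c v u) ×
  (∀ u v w → Adj u v → Adj u w → v ≢ w → c u v ≢ c u w)

ColourAt : ∀ {n l} → Rel n → EdgeColouring n l → Fin n → Fin l → Set
ColourAt Adj c v a = ∃ λ w → Adj v w × c v w ≡ a

Is2SimultaneousEdgeColouring : ∀ {n l} → Rel n → EdgeColouring n l → EdgeColouring n l → Set
Is2SimultaneousEdgeColouring Adj c₁ c₂ =
  IsProperEdgeColouring Adj c₁ ×
  IsProperEdgeColouring Adj c₂ ×
  (∀ v a → ColourAt Adj c₁ v a ⇔ ColourAt Adj c₂ v a) ×
  (∀ u v → Adj u v → c₁ u v ≢ c₂ u v)

TwoSimultaneousEdgeColourable : ∀ {n} → Rel n → Set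
TwoSimultaneousEdgeColourable {n} Adj =
  Σ ℕ λ l → Σ (EdgeColouring n l) λ c₁ → Σ (EdgeColouring n l) λ c₂ →
    Is2SimultaneousEdgeColouring Adj c₁ c₂

-- Subdivision: replace edge xy by a path x v₁ … v_m y with m new vertices.
-- Vertices of the new graph: Fin (n + m); old vertex a is  a ↑ˡ m,
-- new vertex v_{j+1} is  n ↑ʳ j  (j : Fin m).
module Subdivide {n : ℕ} (Adj : Rel n) (x y : Fin n) (m : ℕ) where

  old : Fin n → Fin (n Data.Nat.+ m)
  old a = a ↑ˡ m

  -- the path vertices p₀ = x, p₁ = v₁, …, p_m = v_m, p_{m+1} = y
  pathVertex : Fin (suc (suc m)) → Fin (n Data.Nat.+ m)
  pathVertex zero = old x
  pathVertex (suc i) with toℕ i <? m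
  ... | yes i<m = n ↑ʳ fromℕ< i<m
  ... | no _    = old y

  data SubAdj : Rel (n Data.Nat.+ m) where
    oldEdge : ∀ a b → Adj a b → ¬ (a ≡ x × b ≡ y) → ¬ (a ≡ y × b ≡ x) →
              SubAdj (old a) (old b)
    pathEdge  : (i : Fin (suc m)) →
              SubAdj (pathVertex (inject₁ i)) (pathVertex (suc i))
    pathEdge′ : (i : Fin (suc m)) →
              SubAdj (pathVertex (suc i)) (pathVertex (inject₁ i))

-- Keep both colourings on the old edges and let the new path x v₁ … v_{2k} y, which has
-- 2k + 1 edges, carry the colours α β α … β α under c₁ and β α β … α β under c₂, where
-- α = c₁(xy) and β = c₂(xy). The path edges at x and y carry the colour xy had, so old
-- vertices see the same colour sets as before, every new vertex sees {α, β} under both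
-- colourings, and α ≠ β makes the two colourings disagree on every path edge.
module Submission where

open import Defs
open import Data.Nat using (ℕ; _≤_; _*_)
open import Data.Fin using (Fin)

open import Data.Nat using (zero; suc; _+_; _<_; _<?_; _⊔_)
open import Data.Nat.Properties
  using (suc-injective; n≤1+n; m≥n⇒m⊔n≡m; m≤n⇒m⊔n≡n; ⊔-comm; ≤-antisym; ≮⇒≥; <-irrefl)
open import Data.Nat.Divisibility using (_∣_; divides; m∣m*n)
open import Data.Fin using (zero; suc; toℕ; fromℕ; fromℕ<; _↑ʳ_; inject₁; splitAt; join)
open import Data.Fin.Properties
  using (toℕ-injective; toℕ<n; toℕ-fromℕ; toℕ-fromℕ<; toℕ-inject₁; splitAt-join; join-splitAt)
  renaming (_≟_ to _≟ᶠ_)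
open import Data.Sum using (_⊎_; inj₁; inj₂; [_,_]′; swap)
open import Data.Product using (∃; _×_; _,_; proj₁; proj₂) renaming (swap to ×-swap)
open import Data.Empty using (⊥-elim)
open import Function.Base using (_∘_)
open import Function.Bundles using (_⇔_; mk⇔)
import Function.Properties.Equivalence as ⇔
open import Relation.Binary.PropositionalEquality using (_≡_; _≢_; refl; sym; trans; cong; subst; subst₂)
open import Relation.Nullary using (¬_; yes; no)
open import Relation.Nullary.Decidable using (_×-dec_)

⊎-swap : ∀ {A B : Set} → (A ⊎ B) ⇔ (B ⊎ A)
⊎-swap = mk⇔ swap swap

alternate : ∀ {A : Set} → A → A → ℕ → A
alternate a b zero    = a
alternate a b (suc t) = alternate b a t

alternate-swap-≢ : ∀ {A : Set} {a b : A} → a ≢ b → ∀ t → alternate a b t ≢ alternate b a t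
alternate-swap-≢ a≢b zero    = a≢b
alternate-swap-≢ a≢b (suc t) = alternate-swap-≢ (a≢b ∘ sym) t

alternate-suc-≢ : ∀ {A : Set} {a b : A} → a ≢ b → ∀ t → alternate a b (suc t) ≢ alternate a b t
alternate-suc-≢ a≢b = alternate-swap-≢ (a≢b ∘ sym)

alternate-pair : ∀ {A : Set} {a b c : A} t →
  (c ≡ alternate a b t ⊎ c ≡ alternate a b (suc t)) ⇔ (c ≡ a ⊎ c ≡ b)
alternate-pair zero    = ⇔.refl
alternate-pair (suc t) = ⇔.trans (alternate-pair t) ⊎-swap

alternate-even : ∀ {A : Set} {a b : A} {t} → 2 ∣ t → alternate a b t ≡ a
alternate-even {a = a} {b} (divides q refl) = period-two q
  where
  period-two : ∀ q → alternate a b (q * 2) ≡ a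
  period-two zero    = refl
  period-two (suc q) = period-two q

proper⇒injective : ∀ {n l} {Adj : Rel n} {c : EdgeColouring n l} → IsProperEdgeColouring Adj c →
  ∀ {u v w} → Adj u v → Adj u w → c u v ≡ c u w → v ≡ w
proper⇒injective (_ , proper) {u} {v} {w} uv uw eq with v ≟ᶠ w
... | yes v≡w = v≡w
... | no  v≢w = ⊥-elim (proper u v w uv uw v≢w eq)

module Subdivision {n : ℕ} (Adj : Rel n) (simple : IsSimple Adj) (x y : Fin n) (xy : Adj x y)
                   (m′ : ℕ) (m-even : 2 ∣ suc m′) where

  open Subdivide Adj x y (suc m′)

  m : ℕ
  m = suc m′

  yx : Adj y x
  yx = proj₁ simple x y xy

  x≢y : x ≢ y
  x≢y refl = proj₂ simple x xy

  -- inj₂ j is the path vertex v_{j+1}. On this sum type edges can be analysed by matching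
  -- on constructors, which the embeddings old and n ↑ʳ_ into Fin (n + m) do not allow.
  Vertex : Set
  Vertex = Fin n ⊎ Fin m

  -- x and y enter only through equations, so that matching never has to unify x with y.
  data Predecessor (j : Fin m) : Vertex → Set where
    start : ∀ {a} → a ≡ x → toℕ j ≡ 0 → Predecessor j (inj₁ a)
    inner : ∀ {i} → suc (toℕ i) ≡ toℕ j → Predecessor j (inj₂ i)

  data Successor (j : Fin m) : Vertex → Set where
    end   : ∀ {a} → a ≡ y → suc (toℕ j) ≡ m → Successor j (inj₁ a)
    inner : ∀ {k} → suc (toℕ j) ≡ toℕ k → Successor j (inj₂ k)

  Neighbour : Fin m → Vertex → Set
  Neighbour j q = Predecessor j q ⊎ Successor j q

  data Edge : Vertex → Vertex → Set where
    kept    : ∀ {a b} → Adj a b → ¬ (a ≡ x × b ≡ y) → ¬ (a ≡ y × b ≡ x) → Edge (inj₁ a) (inj₁ b)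
    fromNew : ∀ {j q} → Neighbour j q → Edge (inj₂ j) q
    toNew   : ∀ {j a} → Neighbour j (inj₁ a) → Edge (inj₁ a) (inj₂ j)

  predecessor : ∀ j → ∃ (Predecessor j)
  predecessor zero    = inj₁ x , start refl refl
  predecessor (suc i) = inj₂ (inject₁ i) , inner (cong suc (toℕ-inject₁ i))

  successor : ∀ j → ∃ (Successor j)
  successor j with suc (toℕ j) <? m
  ... | yes j+1<m = inj₂ (fromℕ< j+1<m) , inner (sym (toℕ-fromℕ< j+1<m))
  ... | no  j+1≮m = inj₁ y , end refl (≤-antisym (toℕ<n j) (≮⇒≥ j+1≮m))

  predecessor-unique : ∀ {j q r} → Predecessor j q → Predecessor j r → q ≡ r
  predecessor-unique (start refl _) (start refl _) = refl
  predecessor-unique (start _ j≡0) (inner eq)      with trans eq j≡0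
  ... | ()
  predecessor-unique (inner eq)     (start _ j≡0)  with trans eq j≡0
  ... | ()
  predecessor-unique (inner eq)     (inner eq′)    =
    cong inj₂ (toℕ-injective (suc-injective (trans eq (sym eq′))))

  successor-unique : ∀ {j q r} → Successor j q → Successor j r → q ≡ r
  successor-unique (end refl _) (end refl _) = refl
  successor-unique (end _ eq)   (inner eq′)  = ⊥-elim (<-irrefl (trans (sym eq′) eq) (toℕ<n _))
  successor-unique (inner eq′)  (end _ eq)   = ⊥-elim (<-irrefl (trans (sym eq′) eq) (toℕ<n _))
  successor-unique (inner eq)   (inner eq′)  = cong inj₂ (toℕ-injective (trans (sym eq) eq′))

  end-neighbour-unique : ∀ {a j k} → Neighbour j (inj₁ a) → Neighbour k (inj₁ a) → j ≡ k
  end-neighbour-unique (inj₁ (start _ j≡0)) (inj₁ (start _ k≡0)) = toℕ-injective (trans j≡0 (sym k≡0))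
  end-neighbour-unique (inj₁ (start a≡x _)) (inj₂ (end a≡y _))   = ⊥-elim (x≢y (trans (sym a≡x) a≡y))
  end-neighbour-unique (inj₂ (end a≡y _))   (inj₁ (start a≡x _)) = ⊥-elim (x≢y (trans (sym a≡x) a≡y))
  end-neighbour-unique (inj₂ (end _ eq))    (inj₂ (end _ eq′))   =
    toℕ-injective (suc-injective (trans eq (sym eq′)))

  neighbour-sym : ∀ {j k} → Neighbour j (inj₂ k) → Neighbour k (inj₂ j)
  neighbour-sym (inj₁ (inner eq)) = inj₂ (inner eq)
  neighbour-sym (inj₂ (inner eq)) = inj₁ (inner eq)

  edge-sym : ∀ {p q} → Edge p q → Edge q p
  edge-sym (kept ab ¬xy ¬yx)         = kept (proj₁ simple _ _ ab) (¬yx ∘ ×-swap) (¬xy ∘ ×-swap)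
  edge-sym (fromNew {q = inj₁ _} nb) = toNew nb
  edge-sym (fromNew {q = inj₂ _} nb) = fromNew (neighbour-sym nb)
  edge-sym (toNew nb)                = fromNew nb

  pathVertex-new : ∀ {i : Fin (suc m)} {j : Fin m} → toℕ i ≡ toℕ j → pathVertex (suc i) ≡ n ↑ʳ j
  pathVertex-new {i} {j} eq with toℕ i <? m
  ... | yes i<m = cong (n ↑ʳ_) (toℕ-injective (trans (toℕ-fromℕ< i<m) eq))
  ... | no  i≮m = ⊥-elim (i≮m (subst (_< m) (sym eq) (toℕ<n j)))

  pathVertex-last : ∀ {i : Fin (suc m)} → toℕ i ≡ m → pathVertex (suc i) ≡ old y
  pathVertex-last {i} eq with toℕ i <? m
  ... | yes i<m = ⊥-elim (<-irrefl eq i<m)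
  ... | no  _   = refl

  pathVertex-inject₁ : ∀ j → pathVertex (suc (inject₁ j)) ≡ n ↑ʳ j
  pathVertex-inject₁ j = pathVertex-new (toℕ-inject₁ j)

  pathVertex-successor : ∀ {j q} → Successor j q → pathVertex (suc (suc j)) ≡ join n m q
  pathVertex-successor (end refl eq) = pathVertex-last eq
  pathVertex-successor (inner eq)    = pathVertex-new eq

  splitAt-injective : ∀ {u v} → splitAt n u ≡ splitAt n v → u ≡ v
  splitAt-injective {u} {v} eq =
    trans (sym (join-splitAt n m u)) (trans (cong (join n m) eq) (join-splitAt n m v))

  splitAt-edge : ∀ {u v p q} → u ≡ join n m p → v ≡ join n m q → Edge p q →
                 Edge (splitAt n u) (splitAt n v)
  splitAt-edge {p = p} {q} refl refl e rewrite splitAt-join n m p | splitAt-join n m q = e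

  toEdge-pathEdge : ∀ i → Edge (splitAt n (pathVertex (inject₁ i))) (splitAt n (pathVertex (suc i)))
  toEdge-pathEdge zero    = splitAt-edge refl (pathVertex-new refl) (toNew (inj₁ (start refl refl)))
  toEdge-pathEdge (suc j) =
    splitAt-edge (pathVertex-inject₁ j) (pathVertex-successor s) (fromNew (inj₂ s))
    where s = proj₂ (successor j)

  toEdge : ∀ {u v} → SubAdj u v → Edge (splitAt n u) (splitAt n v)
  toEdge (oldEdge a b ab ¬xy ¬yx) = splitAt-edge refl refl (kept ab ¬xy ¬yx)
  toEdge (pathEdge i)             = toEdge-pathEdge i
  toEdge (pathEdge′ i)            = edge-sym (toEdge-pathEdge i)

  subAdj-sym : ∀ {u v} → SubAdj u v → SubAdj v u
  subAdj-sym (oldEdge a b ab ¬xy ¬yx) = oldEdge b a (proj₁ simple a b ab) (¬yx ∘ ×-swap) (¬xy ∘ ×-swap)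
  subAdj-sym (pathEdge i)             = pathEdge′ i
  subAdj-sym (pathEdge′ i)            = pathEdge i

  start-subAdj : ∀ {j} → toℕ j ≡ 0 → SubAdj (old x) (n ↑ʳ j)
  start-subAdj j≡0 = subst (SubAdj (old x)) (pathVertex-new (sym j≡0)) (pathEdge zero)

  successor-subAdj : ∀ {j q} → Successor j q → SubAdj (n ↑ʳ j) (join n m q)
  successor-subAdj {j} s =
    subst₂ SubAdj (pathVertex-inject₁ j) (pathVertex-successor s) (pathEdge (suc j))

  fromEdge : ∀ {p q} → Edge p q → SubAdj (join n m p) (join n m q)
  fromEdge (kept ab ¬xy ¬yx)                 = oldEdge _ _ ab ¬xy ¬yx
  fromEdge (fromNew (inj₁ (start refl j≡0))) = subAdj-sym (start-subAdj j≡0)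
  fromEdge (fromNew (inj₁ (inner eq)))       = subAdj-sym (successor-subAdj (inner eq))
  fromEdge (fromNew (inj₂ s))                = successor-subAdj s
  fromEdge (toNew (inj₁ (start refl j≡0)))   = start-subAdj j≡0
  fromEdge (toNew (inj₂ s))                  = subAdj-sym (successor-subAdj s)

  liftColouring : ∀ {l} → (Vertex → Vertex → Fin l) → EdgeColouring (n + m) l
  liftColouring f u v = f (splitAt n u) (splitAt n v)

  EdgeColourAt : ∀ {l} → (Vertex → Vertex → Fin l) → Vertex → Fin l → Set
  EdgeColourAt f p col = ∃ λ q → Edge p q × f p q ≡ col

  liftColouring-proper : ∀ {l} {f : Vertex → Vertex → Fin l} →
    (∀ {p q} → Edge p q → f p q ≡ f q p) →
    (∀ {p q r} → Edge p q → Edge p r → f p q ≡ f p r → q ≡ r) →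
    IsProperEdgeColouring SubAdj (liftColouring f)
  liftColouring-proper f-sym f-injective =
    (λ _ _ uv → f-sym (toEdge uv)) ,
    (λ _ _ _ uv uw v≢w eq → v≢w (splitAt-injective (f-injective (toEdge uv) (toEdge uw) eq)))

  liftColouring-colourAt : ∀ {l} (f : Vertex → Vertex → Fin l) u col →
    ColourAt SubAdj (liftColouring f) u col ⇔ EdgeColourAt f (splitAt n u) col
  liftColouring-colourAt f u col = mk⇔
    (λ { (w , uw , eq) → splitAt n w , toEdge uw , eq })
    (λ { (q , e , eq) → join n m q ,
                        subst (λ v → SubAdj v (join n m q)) (join-splitAt n m u) (fromEdge e) ,
                        trans (cong (f (splitAt n u)) (splitAt-join n m q)) eq })

  -- The path edge v_t v_{t+1} (with v₀ = x, v_{m+1} = y) is coloured alternate α β t;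
  -- this is α at both ends because m is even.
  module Extension {l : ℕ} (c : EdgeColouring n l) (β : Fin l) where

    α : Fin l
    α = c x y

    colour : Vertex → Vertex → Fin l
    colour (inj₁ a) (inj₁ b) = c a b
    colour (inj₂ j) (inj₂ k) = alternate α β (toℕ j ⊔ toℕ k)
    colour _        _        = α

    colour-predecessor : ∀ {j q} → Predecessor j q → colour (inj₂ j) q ≡ alternate α β (toℕ j)
    colour-predecessor (start _ j≡0) = sym (cong (alternate α β) j≡0)
    colour-predecessor (inner {i} eq) =
      cong (alternate α β) (m≥n⇒m⊔n≡m (subst (toℕ i ≤_) eq (n≤1+n (toℕ i))))

    colour-successor : ∀ {j q} → Successor j q → colour (inj₂ j) q ≡ alternate α β (suc (toℕ j))
    colour-successor (end _ eq) = sym (trans (cong (alternate α β) eq) (alternate-even m-even))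
    colour-successor {j} (inner eq) =
      cong (alternate α β) (trans (m≤n⇒m⊔n≡n (subst (toℕ j ≤_) eq (n≤1+n (toℕ j)))) (sym eq))

    colours-at-new : ∀ j col → EdgeColourAt colour (inj₂ j) col ⇔ (col ≡ α ⊎ col ≡ β)
    colours-at-new j col = ⇔.trans (mk⇔ to from) (alternate-pair (toℕ j))
      where
      OnPathEdge : Set
      OnPathEdge = col ≡ alternate α β (toℕ j) ⊎ col ≡ alternate α β (suc (toℕ j))

      to : EdgeColourAt colour (inj₂ j) col → OnPathEdge
      to (_ , fromNew (inj₁ p) , eq) = inj₁ (trans (sym eq) (colour-predecessor p))
      to (_ , fromNew (inj₂ s) , eq) = inj₂ (trans (sym eq) (colour-successor s))

      from : OnPathEdge → EdgeColourAt colour (inj₂ j) col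
      from (inj₁ eq) = let q , p = predecessor j in
                       q , fromNew (inj₁ p) , trans (colour-predecessor p) (sym eq)
      from (inj₂ eq) = let q , s = successor j in
                       q , fromNew (inj₂ s) , trans (colour-successor s) (sym eq)

    module _ (proper : IsProperEdgeColouring Adj c) where

      c-sym : ∀ {a b} → Adj a b → c a b ≡ c b a
      c-sym = proj₁ proper _ _

      colour-sym : ∀ {p q} → Edge p q → colour p q ≡ colour q p
      colour-sym {inj₁ _} {inj₁ _} (kept ab _ _) = c-sym ab
      colour-sym {inj₁ _} {inj₂ _} _             = refl
      colour-sym {inj₂ _} {inj₁ _} _             = refl
      colour-sym {inj₂ j} {inj₂ k} _             = cong (alternate α β) (⊔-comm (toℕ j) (toℕ k))

      α-at-end : ∀ {a b j} → Neighbour j (inj₁ a) → Adj a b → c a b ≡ α →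
                 (a ≡ x × b ≡ y) ⊎ (a ≡ y × b ≡ x)
      α-at-end (inj₁ (start refl _)) xb eq = inj₁ (refl , proper⇒injective proper xb xy eq)
      α-at-end (inj₂ (end refl _))   yb eq =
        inj₂ (refl , proper⇒injective proper yb yx (trans eq (c-sym xy)))

      colours-at-old : ∀ a col → EdgeColourAt colour (inj₁ a) col ⇔ ColourAt Adj c a col
      colours-at-old a col = mk⇔ to from
        where
        to : EdgeColourAt colour (inj₁ a) col → ColourAt Adj c a col
        to (inj₁ b , kept ab _ _ , eq)                 = b , ab , eq
        to (inj₂ _ , toNew (inj₁ (start refl _)) , eq) = y , xy , eq
        to (inj₂ _ , toNew (inj₂ (end refl _)) , eq)   = x , yx , trans (sym (c-sym xy)) eq

        from : ColourAt Adj c a col → EdgeColourAt colour (inj₁ a) col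
        from (b , ab , eq) with (a ≟ᶠ x) ×-dec (b ≟ᶠ y)
        ... | yes (refl , refl) = inj₂ zero , toNew (inj₁ (start refl refl)) , eq
        ... | no ¬xy with (a ≟ᶠ y) ×-dec (b ≟ᶠ x)
        ...   | yes (refl , refl) =
          inj₂ (fromℕ m′) , toNew (inj₂ (end refl (cong suc (toℕ-fromℕ m′)))) , trans (c-sym xy) eq
        ...   | no ¬yx = inj₁ b , kept ab ¬xy ¬yx , eq

      module _ (α≢β : α ≢ β) where

        neighbour-injective : ∀ {j q r} → Neighbour j q → Neighbour j r →
                              colour (inj₂ j) q ≡ colour (inj₂ j) r → q ≡ r
        neighbour-injective (inj₁ p) (inj₁ p′) _ = predecessor-unique p p′
        neighbour-injective (inj₂ s) (inj₂ s′) _ = successor-unique s s′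
        neighbour-injective {j} (inj₁ p) (inj₂ s) eq = ⊥-elim (alternate-suc-≢ α≢β (toℕ j)
          (trans (sym (colour-successor s)) (trans (sym eq) (colour-predecessor p))))
        neighbour-injective {j} (inj₂ s) (inj₁ p) eq = ⊥-elim (alternate-suc-≢ α≢β (toℕ j)
          (trans (sym (colour-successor s)) (trans eq (colour-predecessor p))))

        colour-injective : ∀ {p q r} → Edge p q → Edge p r → colour p q ≡ colour p r → q ≡ r
        colour-injective (kept ab _ _) (kept ab′ _ _) eq =
          cong inj₁ (proper⇒injective proper ab ab′ eq)
        colour-injective (kept ab ¬xy ¬yx) (toNew nb) eq =
          ⊥-elim ([ ¬xy , ¬yx ]′ (α-at-end nb ab eq))
        colour-injective (toNew nb) (kept ab ¬xy ¬yx) eq =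
          ⊥-elim ([ ¬xy , ¬yx ]′ (α-at-end nb ab (sym eq)))
        colour-injective (toNew nb) (toNew nb′) _ = cong inj₂ (end-neighbour-unique nb nb′)
        colour-injective (fromNew nb) (fromNew nb′) eq = neighbour-injective nb nb′ eq

  module _ {l} {c₁ c₂ : EdgeColouring n l}
           (proper₁ : IsProperEdgeColouring Adj c₁) (proper₂ : IsProperEdgeColouring Adj c₂)
           (same-colours-old : ∀ a col → ColourAt Adj c₁ a col ⇔ ColourAt Adj c₂ a col)
           (distinct : ∀ a b → Adj a b → c₁ a b ≢ c₂ a b) where

    private
      α≢β : c₁ x y ≢ c₂ x y
      α≢β = distinct x y xy

      module E₁ = Extension c₁ (c₂ x y)
      module E₂ = Extension c₂ (c₁ x y)

    same-colours : ∀ p col → EdgeColourAt E₁.colour p col ⇔ EdgeColourAt E₂.colour p col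
    same-colours (inj₁ a) col =
      ⇔.trans (E₁.colours-at-old proper₁ a col)
        (⇔.trans (same-colours-old a col) (⇔.sym (E₂.colours-at-old proper₂ a col)))
    same-colours (inj₂ j) col =
      ⇔.trans (E₁.colours-at-new j col) (⇔.trans ⊎-swap (⇔.sym (E₂.colours-at-new j col)))

    colours-differ : ∀ {p q} → Edge p q → E₁.colour p q ≢ E₂.colour p q
    colours-differ {inj₁ a} {inj₁ b} (kept ab _ _) = distinct a b ab
    colours-differ {inj₁ _} {inj₂ _} _             = α≢β
    colours-differ {inj₂ _} {inj₁ _} _             = α≢β
    colours-differ {inj₂ j} {inj₂ k} _             = alternate-swap-≢ α≢β (toℕ j ⊔ toℕ k)

    subdivision-simultaneous :
      Is2SimultaneousEdgeColouring SubAdj (liftColouring E₁.colour) (liftColouring E₂.colour)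
    subdivision-simultaneous =
      liftColouring-proper (E₁.colour-sym proper₁) (E₁.colour-injective proper₁ α≢β) ,
      liftColouring-proper (E₂.colour-sym proper₂) (E₂.colour-injective proper₂ (α≢β ∘ sym)) ,
      (λ u col → ⇔.trans (liftColouring-colourAt E₁.colour u col)
                   (⇔.trans (same-colours (splitAt n u) col)
                            (⇔.sym (liftColouring-colourAt E₂.colour u col)))) ,
      (λ _ _ uv → colours-differ (toEdge uv))

theorem3p2 : (n : ℕ) (Adj : Rel n) → IsSimple Adj →
    TwoSimultaneousEdgeColourable Adj →
    (x y : Fin n) → Adj x y → (k : ℕ) → 1 ≤ k →
    TwoSimultaneousEdgeColourable (Subdivide.SubAdj Adj x y (2 * k))
theorem3p2 n Adj simple (l , _ , _ , proper₁ , proper₂ , same-colours , distinct) x y xy (suc k) _ =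
  l , _ , _ ,
  Subdivision.subdivision-simultaneous Adj simple x y xy _ (m∣m*n (suc k))
    proper₁ proper₂ same-colours distinct
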